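{- Let $q,q',n$ be integers with $q'\ge 2q+2$, $q>1$ and $n>1$. Let $S$ be an $\mathcal{OS}_q(n)$ of period $m$ with ring sequence $[s_0,\ldots,s_{m-1}]$, $s_0=0$. Let $t_i=(-1)^{i+m-1}s'_i$ if $s'_i\neq0$ and $t_i=(-1)^{i+m-1}q$ (in $\mathbb{Z}_{q'}$) if $s'_i=0$, and let $U$ be the sequence over $\mathbb{Z}_{q'}$ with ring sequence $[s'_0,\ldots,s'_{m-1},-s'_0,\ldots,-s'_{m-1},t_0,\ldots,t_{m-1},-t_0,\ldots,-t_{m-1}]$ (its ring sequence contains an even number of zeros). Let $U'$ be obtained from $U$ by replacing half of the zeros in its ring sequence by $q+1$ and the other half by $q'-q-1$. Then $U'$ is a good $\mathcal{SOS}_{q'}(n)$ of the same period as $U$, and $w_{q'}(U')=0$.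
   Context: For $x\in\mathbb{Z}_q$, $x'$ denotes the residue class in $\mathbb{Z}_{q'}$ of the unique integer in $\{0,\ldots,q-1\}$ representing $x$. A periodic sequence is described by its ring sequence (one period). Write $\mathbf{s}_n(i)=(s_i,\ldots,s_{i+n-1})$; for an $n$-tuple $\mathbf{u}$, $\mathbf{u}^R$ is its reverse and $-\mathbf{u}$ its entrywise negative. An $n$-window sequence of period $m$ is one where $\mathbf{s}_n(i)=\mathbf{s}_n(j)$ implies $i\equiv j\pmod m$. An $\mathcal{OS}_q(n)$ is an $n$-window sequence over $\mathbb{Z}_q$ with $\mathbf{s}_n(i)\neq\mathbf{s}_n(j)^R$ for all $i,j$; an $\mathcal{SOS}_q(n)$ is an $\mathcal{OS}_q(n)$ with additionally $\mathbf{s}_n(i)\neq-\mathbf{s}_n(j)^R$ for all $i,j$. Such a sequence is good if every run of consecutive $0$s (in the periodic sequence) has length at most $n-2$. The weight $w(U)$ of a sequence over $\mathbb{Z}_{q'}$ is the sum of the terms of its ring sequence, each treated as an integer in $[0,q'-1]$; $w_{q'}(U)=w(U)\bmod q'$. -}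

module Defs where

open import Data.Nat.Base using (ℕ; zero; suc; _+_; _*_; _∸_; _%_; _≡ᵇ_; NonZero)
open import Data.Nat.DivMod using (_mod_)
open import Data.Fin.Base using (Fin; toℕ)
open import Data.Vec.Base using (Vec; lookup; tabulate; reverse; map; zipWith; sum; _++_)
open import Data.Bool.Base using (Bool; true; false; if_then_else_; _∧_)
open import Data.Product.Base using (_×_)
open import Relation.Binary.PropositionalEquality using (_≡_; _≢_)
open import Relation.Nullary.Negation using (¬_)

-- Elements of ℤ_q are represented by Fin q (canonical representatives 0..q-1).

neg : {q : ℕ} .{{_ : NonZero q}} → Fin q → Fin q
neg {q} x = (q ∸ toℕ x) mod q

-- x ↦ x' : ℤ_q → ℤ_{q'} (representative in {0..q-1} reduced mod q')
lift : {q : ℕ} (q' : ℕ) .{{_ : NonZero q'}} → Fin q → Fin q'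
lift q' x = toℕ x mod q'

isZero : {q : ℕ} → Fin q → Bool
isZero x = toℕ x ≡ᵇ 0

term : {A : Set} {m : ℕ} .{{_ : NonZero m}} → Vec A m → ℕ → A
term {m = m} r i = lookup r (i mod m)

window : {A : Set} {m : ℕ} .{{_ : NonZero m}} → (n : ℕ) → Vec A m → ℕ → Vec A n
window n r i = tabulate (λ k → term r (i + toℕ k))

IsWindowSeq : {A : Set} {m : ℕ} .{{_ : NonZero m}} → ℕ → Vec A m → Set
IsWindowSeq {m = m} n r =
  ∀ (i j : ℕ) → window n r i ≡ window n r j → i % m ≡ j % m

IsOS : {q m : ℕ} .{{_ : NonZero m}} → ℕ → Vec (Fin q) m → Set
IsOS n r = IsWindowSeq n r × (∀ (i j : ℕ) → window n r i ≢ reverse (window n r j))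

IsSOS : {q m : ℕ} .{{_ : NonZero q}} .{{_ : NonZero m}} → ℕ → Vec (Fin q) m → Set
IsSOS n r = IsOS n r × (∀ (i j : ℕ) → window n r i ≢ map neg (reverse (window n r j)))

-- good: every run of consecutive zeros of the periodic sequence has length ≤ n-2,
-- i.e. there are never n-1 consecutive zeros.
IsGood : {q m : ℕ} .{{_ : NonZero m}} → ℕ → Vec (Fin q) m → Set
IsGood n r = ∀ (i : ℕ) → ¬ (∀ (k : Fin (n ∸ 1)) → toℕ (term r (i + toℕ k)) ≡ 0)

weight : {q m : ℕ} → Vec (Fin q) m → ℕ
weight r = sum (map toℕ r)

signed : {q' : ℕ} .{{_ : NonZero q'}} → ℕ → Fin q' → Fin q'
signed e x = if (e % 2 ≡ᵇ 0) then x else neg x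

tSeq : {q m : ℕ} (q' : ℕ) .{{_ : NonZero q'}} → Vec (Fin q) m → Vec (Fin q') m
tSeq {q} {m} q' s = tabulate λ i →
  signed (toℕ i + m ∸ 1)
    (if isZero (lift q' (lookup s i)) then q mod q' else lift q' (lookup s i))

USeq : {q m : ℕ} (q' : ℕ) .{{_ : NonZero q'}} → Vec (Fin q) m → Vec (Fin q') (m + m + (m + m))
USeq q' s = (s' ++ map neg s') ++ (tSeq q' s ++ map neg (tSeq q' s))
  where s' = map (lift q') s

zerosLabelled : {q' k : ℕ} → Bool → Vec (Fin q') k → Vec Bool k → ℕ
zerosLabelled b u c = sum (zipWith (λ x c' → if isZero x ∧ (c' ≡ᵇool b) then 1 else 0) u c)
  where
  _≡ᵇool_ : Bool → Bool → Bool
  true ≡ᵇool true = true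
  false ≡ᵇool false = true
  _ ≡ᵇool _ = false

replaceZeros : {k : ℕ} (q q' : ℕ) .{{_ : NonZero q'}} → Vec (Fin q') k → Vec Bool k → Vec (Fin q') k
replaceZeros q q' u c =
  zipWith (λ x c' → if isZero x then (if c' then (q + 1) mod q' else (q' ∸ q ∸ 1) mod q') else x) u c

instance
  nz4 : {m : ℕ} → .{{_ : NonZero m}} → NonZero (m + m + (m + m))
  nz4 {suc m} = _

-- Write the ring sequence of U′ as four blocks s′, −s′, t, −t of length m.  At offset j every
-- entry is ±a in ℤ_q', with a = s_j if s_j ≠ 0, while a zero s_j gives a = q + 1 in the
-- s-blocks (the replaced zeros) and a = q in the t-blocks.  Since 2(q + 1) ≤ q', the absolute
-- value min(y, q' − y) recovers a, so y ↦ (|y| if |y| < q, else 0) sends U′ termwise to S and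
-- is invariant under negation.  A window of U′ equal to a reversed or negated reversed window
-- therefore projects to a window of S equal to a reversed one, which S excludes; and equal
-- windows of U′ start at positions congruent mod m.  Comparing signs, windows 2m apart would
-- need two consecutive t-signs (−1)^(j+m−1) equal to +1, and windows m or 3m apart would need
-- s to vanish on a whole window, a palindrome; the block boundaries are handled by the t-sign
-- being +1 at the last offset and by s_0 = 0.  Finally U′ has no zeros, and its weight is a
-- multiple of q' because x + (−x) ∈ {0, q'} and the replaced zeros pair up to q'.

module Submission where

open import Data.Bool.Base using (Bool; true; false; not; if_then_else_)
open import Data.Bool.Properties using (not-¬; not-injective)
open import Data.Empty using (⊥-elim)
open import Data.Fin.Base using (Fin; zero; toℕ; fromℕ<; _↑ˡ_; _↑ʳ_)
open import Data.Fin.Properties using (toℕ-injective; toℕ-fromℕ<; toℕ<n; toℕ-↑ˡ; toℕ-↑ʳ)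
open import Data.Nat.Base
open import Data.Nat.DivMod
open import Data.Nat.Divisibility using (_∣_; divides; ∣m∣n⇒∣m+n; n∣m*n; n∣m⇒m%n≡0)
open import Data.Nat.Properties
open import Data.Nat.Tactic.RingSolver using (solve-∀)
open import Data.Product.Base using (Σ; _×_; _,_; proj₁; proj₂)
open import Data.Sum.Base using (_⊎_; inj₁; inj₂)
open import Data.Vec.Base using (Vec; []; _∷_; lookup; tabulate; reverse; map; zipWith; replicate; sum; _++_)
open import Data.Vec.Properties
  using (∷-injective; lookup∘tabulate; tabulate-∘; tabulate-cong; tabulate∘lookup; lookup-map; lookup-zipWith;
         lookup-++ˡ; lookup-++ʳ; lookup-replicate; map-reverse; map-∘; map-cong; map-++; map-const; sum-++)
open import Function.Base using (_∘_)
open import Relation.Binary.PropositionalEquality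
open import Relation.Nullary.Decidable using (Dec; yes; no)
open import Relation.Nullary.Negation using (contradiction)

open import Defs

toℕ-mod : ∀ x d .{{_ : NonZero d}} → toℕ (x mod d) ≡ x % d
toℕ-mod x d = toℕ-fromℕ< _

%-cong-+ʳ : ∀ {x y} a d .{{_ : NonZero d}} → x % d ≡ y % d → (x + a) % d ≡ (y + a) % d
%-cong-+ʳ {x} {y} a d eq = begin
  (x + a) % d              ≡⟨ %-distribˡ-+ x a d ⟩
  (x % d + a % d) % d      ≡⟨ cong (λ z → (z + a % d) % d) eq ⟩
  (y % d + a % d) % d      ≡⟨ %-distribˡ-+ y a d ⟨
  (y + a) % d              ∎
  where open ≡-Reasoning

map-injective : ∀ {A B : Set} {f : A → B} {k} → (∀ {x y} → f x ≡ f y → x ≡ y) →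
                {xs ys : Vec A k} → map f xs ≡ map f ys → xs ≡ ys
map-injective f-inj {[]}     {[]}     _  = refl
map-injective f-inj {x ∷ xs} {y ∷ ys} eq with ∷-injective eq
... | fx≡fy , fxs≡fys = cong₂ _∷_ (f-inj fx≡fy) (map-injective f-inj fxs≡fys)

reverse-replicate : ∀ {A : Set} n (a : A) → reverse (replicate n a) ≡ replicate n a
reverse-replicate n a = begin
  reverse (replicate n a)                    ≡⟨ cong reverse (map-const (replicate n a) a) ⟨
  reverse (map (λ _ → a) (replicate n a))    ≡⟨ map-reverse (λ _ → a) (replicate n a) ⟨
  map (λ _ → a) (reverse (replicate n a))    ≡⟨ map-const (reverse (replicate n a)) a ⟩
  replicate n a                              ∎
  where open ≡-Reasoning

module _ {A : Set} {k : ℕ} .{{_ : NonZero k}} (r : Vec A k) where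

  term-cong : ∀ {x y} → x % k ≡ y % k → term r x ≡ term r y
  term-cong {x} {y} eq =
    cong (lookup r) (toℕ-injective (trans (toℕ-mod x k) (trans eq (sym (toℕ-mod y k)))))

  window-cong : ∀ n {x y} → x % k ≡ y % k → window n r x ≡ window n r y
  window-cong n eq = tabulate-cong (λ i → term-cong (%-cong-+ʳ (toℕ i) k eq))

  window-≡⇒term-≡ : ∀ {n x y} → window n r x ≡ window n r y →
                    ∀ {i} → i < n → term r (x + i) ≡ term r (y + i)
  window-≡⇒term-≡ {n} {x} {y} eq {i} i<n = begin
    term r (x + i)                     ≡⟨ entry x ⟨
    lookup (window n r x) (fromℕ< i<n) ≡⟨ cong (λ w → lookup w (fromℕ< i<n)) eq ⟩
    lookup (window n r y) (fromℕ< i<n) ≡⟨ entry y ⟩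
    term r (y + i)                     ∎
    where
    open ≡-Reasoning
    entry : ∀ z → lookup (window n r z) (fromℕ< i<n) ≡ term r (z + i)
    entry z = trans (lookup∘tabulate _ (fromℕ< i<n)) (cong (λ j → term r (z + j)) (toℕ-fromℕ< i<n))

  window-const : ∀ {n x} {a : A} → (∀ {i} → i < n → term r (x + i) ≡ a) → window n r x ≡ replicate n a
  window-const {n} {x} {a} const = begin
    window n r x                      ≡⟨ tabulate-cong (λ i → trans (const (toℕ<n i)) (sym (lookup-replicate i a))) ⟩
    tabulate (lookup (replicate n a)) ≡⟨ tabulate∘lookup (replicate n a) ⟩
    replicate n a                     ∎
    where open ≡-Reasoning

map-window : ∀ {A B C : Set} {k l} .{{_ : NonZero k}} .{{_ : NonZero l}} (r : Vec A k) (s : Vec B l)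
             {f : A → C} {g : B → C} → (∀ x → f (term r x) ≡ g (term s x)) →
             ∀ n x → map f (window n r x) ≡ map g (window n s x)
map-window r s {f} {g} f∘r≗g∘s n x = begin
  map f (window n r x)                    ≡⟨ tabulate-∘ f _ ⟨
  tabulate (λ i → f (term r (x + toℕ i))) ≡⟨ tabulate-cong (λ i → f∘r≗g∘s (x + toℕ i)) ⟩
  tabulate (λ i → g (term s (x + toℕ i))) ≡⟨ tabulate-∘ g _ ⟩
  map g (window n s x)                    ∎
  where open ≡-Reasoning

module Projection {q Q k l : ℕ} .{{_ : NonZero Q}} .{{_ : NonZero k}} .{{_ : NonZero l}}
                  (r : Vec (Fin Q) k) (s : Vec (Fin q) l) (π : Fin Q → ℕ)
                  (π-r : ∀ x → π (term r x) ≡ toℕ (term s x)) (n : ℕ) where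

  private
    reflect : ∀ {x Y Z} → window n r x ≡ Y → map π Y ≡ map toℕ Z → window n s x ≡ Z
    reflect {x} eq πY≡ =
      map-injective toℕ-injective (trans (sym (map-window r s π-r n x)) (trans (cong (map π) eq) πY≡))

    map-reverse-window : ∀ y → map π (reverse (window n r y)) ≡ map toℕ (reverse (window n s y))
    map-reverse-window y = begin
      map π (reverse (window n r y))     ≡⟨ map-reverse π (window n r y) ⟩
      reverse (map π (window n r y))     ≡⟨ cong reverse (map-window r s π-r n y) ⟩
      reverse (map toℕ (window n s y))   ≡⟨ map-reverse toℕ (window n s y) ⟨
      map toℕ (reverse (window n s y))   ∎
      where open ≡-Reasoning

  window-≡-reflect : ∀ {x y} → window n r x ≡ window n r y → window n s x ≡ window n s y
  window-≡-reflect {y = y} eq = reflect eq (map-window r s π-r n y)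

  reverse-reflect : ∀ {x y} → window n r x ≡ reverse (window n r y) → window n s x ≡ reverse (window n s y)
  reverse-reflect {y = y} eq = reflect eq (map-reverse-window y)

  neg-reverse-reflect : (∀ a → π (neg a) ≡ π a) →
    ∀ {x y} → window n r x ≡ map neg (reverse (window n r y)) → window n s x ≡ reverse (window n s y)
  neg-reverse-reflect π∘neg≗π {y = y} eq =
    reflect eq (trans (sym (map-∘ π neg _)) (trans (map-cong π∘neg≗π _) (map-reverse-window y)))

zipWith-cong : ∀ {A B C : Set} {f g : A → B → C} {k} → (∀ x y → f x y ≡ g x y) →
               (xs : Vec A k) (ys : Vec B k) → zipWith f xs ys ≡ zipWith g xs ys
zipWith-cong f≗g []       []       = refl
zipWith-cong f≗g (x ∷ xs) (y ∷ ys) = cong₂ _∷_ (f≗g x y) (zipWith-cong f≗g xs ys)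

even : ℕ → Bool
even e = e % 2 ≡ᵇ 0

even-suc : ∀ e → even (suc e) ≡ not (even e)
even-suc 0             = refl
even-suc 1             = refl
even-suc (suc (suc e)) = even-suc e

even-+-self : ∀ e → even (e + e) ≡ true
even-+-self zero    = refl
even-+-self (suc e) rewrite +-suc e e = even-+-self e

if-isZero-zero : ∀ {k} {A : Set} {y : Fin k} {a b : A} → toℕ y ≡ 0 → (if isZero y then a else b) ≡ a
if-isZero-zero {y = y} y≡0 with toℕ y
if-isZero-zero refl | .0 = refl

if-isZero-nonzero : ∀ {k} {A : Set} {y : Fin k} {a b : A} → toℕ y ≢ 0 → (if isZero y then a else b) ≡ b
if-isZero-nonzero {y = y} y≢0 with toℕ y
... | zero  = contradiction refl y≢0
... | suc _ = refl

no-zeros⇒good : ∀ {q k n} .{{_ : NonZero k}} (r : Vec (Fin q) k) →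
                (∀ x → toℕ (term r x) ≢ 0) → 1 < n → IsGood n r
no-zeros⇒good {n = suc (suc _)} r nonzero _ i all-zero = nonzero (i + 0) (all-zero zero)
no-zeros⇒good {n = suc zero} r nonzero (s≤s ())

weight-++ : ∀ {q k l} (xs : Vec (Fin q) k) (ys : Vec (Fin q) l) → weight (xs ++ ys) ≡ weight xs + weight ys
weight-++ xs ys = trans (cong sum (map-++ toℕ xs ys)) (sum-++ (map toℕ xs))

clip : ℕ → ℕ → ℕ
clip q a with a <? q
... | yes _ = a
... | no _  = 0

clip-< : ∀ {q a} → a < q → clip q a ≡ a
clip-< {q} {a} a<q with a <? q
... | yes _   = refl
... | no a≮q = contradiction a<q a≮q

clip-≥ : ∀ {q a} → q ≤ a → clip q a ≡ 0
clip-≥ {q} {a} q≤a with a <? q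
... | yes a<q = contradiction a<q (≤⇒≯ q≤a)
... | no _    = refl

module Signed (Q : ℕ) .{{_ : NonZero Q}} where

  sgn : Bool → Fin Q → Fin Q
  sgn σ x = if σ then x else neg x

  withSign : Bool → ℕ → ℕ
  withSign σ a = if σ then a else Q ∸ a

  toℕ-neg : (x : Fin Q) → toℕ x ≢ 0 → toℕ (neg x) ≡ Q ∸ toℕ x
  toℕ-neg x x≢0 =
    trans (toℕ-mod (Q ∸ toℕ x) Q) (m<n⇒m%n≡m (∸-monoʳ-< (n≢0⇒n>0 x≢0) (<⇒≤ (toℕ<n x))))

  toℕ-neg-0 : (x : Fin Q) → toℕ x ≡ 0 → toℕ (neg x) ≡ 0
  toℕ-neg-0 x x≡0 = trans (toℕ-mod (Q ∸ toℕ x) Q) (trans (cong (λ a → (Q ∸ a) % Q) x≡0) (n%n≡0 Q))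

  neg-involutive : (x : Fin Q) → neg (neg x) ≡ x
  neg-involutive x = toℕ-injective (case-zero (toℕ x ≟ 0))
    where
    case-zero : Dec (toℕ x ≡ 0) → toℕ (neg (neg x)) ≡ toℕ x
    case-zero (yes x≡0) = trans (toℕ-neg-0 (neg x) (toℕ-neg-0 x x≡0)) (sym x≡0)
    case-zero (no x≢0)  = begin
      toℕ (neg (neg x)) ≡⟨ toℕ-neg (neg x) neg-x≢0 ⟩
      Q ∸ toℕ (neg x)   ≡⟨ cong (Q ∸_) (toℕ-neg x x≢0) ⟩
      Q ∸ (Q ∸ toℕ x)   ≡⟨ m∸[m∸n]≡n (<⇒≤ (toℕ<n x)) ⟩
      toℕ x             ∎
      where
      open ≡-Reasoning
      neg-x≢0 : toℕ (neg x) ≢ 0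
      neg-x≢0 = subst (_≢ 0) (sym (toℕ-neg x x≢0)) (m>n⇒m∸n≢0 (toℕ<n x))

  neg-sgn : ∀ σ x → neg (sgn σ x) ≡ sgn (not σ) x
  neg-sgn true  x = refl
  neg-sgn false x = neg-involutive x

  toℕ-sgn : ∀ σ (x : Fin Q) → toℕ x ≢ 0 → toℕ (sgn σ x) ≡ withSign σ (toℕ x)
  toℕ-sgn true  x x≢0 = refl
  toℕ-sgn false x x≢0 = toℕ-neg x x≢0

  toℕ-sgn-0 : ∀ σ (x : Fin Q) → toℕ x ≡ 0 → toℕ (sgn σ x) ≡ 0
  toℕ-sgn-0 true  x x≡0 = x≡0
  toℕ-sgn-0 false x x≡0 = toℕ-neg-0 x x≡0

  withSign-nonzero : ∀ σ {a} → a ≢ 0 → a < Q → withSign σ a ≢ 0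
  withSign-nonzero true  a≢0 a<Q = a≢0
  withSign-nonzero false a≢0 a<Q = m>n⇒m∸n≢0 a<Q

  fold : ℕ → ℕ
  fold y = y ⊓ (Q ∸ y)

  fold-∸ : ∀ {y} → y ≤ Q → fold (Q ∸ y) ≡ fold y
  fold-∸ {y} y≤Q = trans (cong ((Q ∸ y) ⊓_) (m∸[m∸n]≡n y≤Q)) (⊓-comm (Q ∸ y) y)

  fold-withSign : ∀ σ {a} → a ≤ Q → fold (withSign σ a) ≡ fold a
  fold-withSign true  a≤Q = refl
  fold-withSign false a≤Q = fold-∸ a≤Q

  fold-small : ∀ {a} → a + a ≤ Q → fold a ≡ a
  fold-small {a} 2a≤Q = m≤n⇒m⊓n≡m (≤-trans (≤-reflexive (sym (m+n∸n≡m a a))) (∸-monoˡ-≤ a 2a≤Q))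

  fold-neg : (x : Fin Q) → fold (toℕ (neg x)) ≡ fold (toℕ x)
  fold-neg x with toℕ x ≟ 0
  ... | yes x≡0 = cong fold (trans (toℕ-neg-0 x x≡0) (sym x≡0))
  ... | no x≢0  = trans (cong fold (toℕ-neg x x≢0)) (fold-∸ (<⇒≤ (toℕ<n x)))

  withSign-injectiveʳ : ∀ σ σ′ {a a′} → a + a ≤ Q → a′ + a′ ≤ Q →
                        withSign σ a ≡ withSign σ′ a′ → a ≡ a′
  withSign-injectiveʳ σ σ′ {a} {a′} 2a≤Q 2a′≤Q eq = begin
    a                     ≡⟨ fold-small 2a≤Q ⟨
    fold a                ≡⟨ fold-withSign σ (≤-trans (m≤m+n a a) 2a≤Q) ⟨
    fold (withSign σ a)   ≡⟨ cong fold eq ⟩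
    fold (withSign σ′ a′) ≡⟨ fold-withSign σ′ (≤-trans (m≤m+n a′ a′) 2a′≤Q) ⟩
    fold a′               ≡⟨ fold-small 2a′≤Q ⟩
    a′                    ∎
    where open ≡-Reasoning

  withSign-injectiveˡ : ∀ σ σ′ {a} → a + a < Q → withSign σ a ≡ withSign σ′ a → σ ≡ σ′
  withSign-injectiveˡ true  true  _    _  = refl
  withSign-injectiveˡ false false _    _  = refl
  withSign-injectiveˡ true  false {a} 2a<Q eq = contradiction eq′ (<⇒≢ 2a<Q)
    where eq′ = trans (cong (a +_) eq) (m+[n∸m]≡n (≤-trans (m≤m+n a a) (<⇒≤ 2a<Q)))
  withSign-injectiveˡ false true  {a} 2a<Q eq = contradiction eq′ (<⇒≢ 2a<Q)
    where eq′ = trans (cong (a +_) (sym eq)) (m+[n∸m]≡n (≤-trans (m≤m+n a a) (<⇒≤ 2a<Q)))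

  ∣weight-++-neg : ∀ {k} (xs : Vec (Fin Q) k) → Q ∣ weight (xs ++ map neg xs)
  ∣weight-++-neg xs = subst (Q ∣_) (sym (weight-++ xs (map neg xs))) (pairs xs)
    where
    ∣x+neg-x : (x : Fin Q) → Q ∣ toℕ x + toℕ (neg x)
    ∣x+neg-x x with toℕ x ≟ 0
    ... | yes x≡0 = divides 0 (cong₂ _+_ x≡0 (toℕ-neg-0 x x≡0))
    ... | no x≢0  = divides 1 (trans (cong (toℕ x +_) (toℕ-neg x x≢0))
                                     (trans (m+[n∸m]≡n (<⇒≤ (toℕ<n x))) (sym (+-identityʳ Q))))
    pairs : ∀ {k} (xs : Vec (Fin Q) k) → Q ∣ weight xs + weight (map neg xs)
    pairs []       = divides 0 refl
    pairs (x ∷ xs) = subst (Q ∣_) (swap (toℕ x) (toℕ (neg x)) (weight xs) (weight (map neg xs)))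
                           (∣m∣n⇒∣m+n (∣x+neg-x x) (pairs xs))
      where
      swap : ∀ a b w v → a + b + (w + v) ≡ a + w + (b + v)
      swap = solve-∀

  project : ℕ → ℕ → ℕ
  project q y = clip q (fold y)

  project-withSign : ∀ q σ {a} → a + a ≤ Q → project q (withSign σ a) ≡ clip q a
  project-withSign q σ {a} 2a≤Q =
    cong (clip q) (trans (fold-withSign σ (≤-trans (m≤m+n a a) 2a≤Q)) (fold-small 2a≤Q))

  project-neg : ∀ q x → project q (toℕ (neg x)) ≡ project q (toℕ x)
  project-neg q x = cong (clip q) (fold-neg x)

module Replacement (q Q : ℕ) .{{_ : NonZero Q}} (q+1<Q : q + 1 < Q) where

  open Signed Q

  replaceZero : Fin Q → Bool → Fin Q
  replaceZero x b = if isZero x then (if b then (q + 1) mod Q else (Q ∸ q ∸ 1) mod Q) else x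

  toℕ-replacement : ∀ b → toℕ (if b then (q + 1) mod Q else (Q ∸ q ∸ 1) mod Q) ≡ withSign b (q + 1)
  toℕ-replacement true  = trans (toℕ-mod (q + 1) Q) (m<n⇒m%n≡m q+1<Q)
  toℕ-replacement false = begin
    toℕ ((Q ∸ q ∸ 1) mod Q) ≡⟨ toℕ-mod (Q ∸ q ∸ 1) Q ⟩
    (Q ∸ q ∸ 1) % Q         ≡⟨ cong (_% Q) (∸-+-assoc Q q 1) ⟩
    (Q ∸ (q + 1)) % Q       ≡⟨ m<n⇒m%n≡m (∸-monoʳ-< (m≤n+m 1 q) (<⇒≤ q+1<Q)) ⟩
    Q ∸ (q + 1)             ∎
    where open ≡-Reasoning

  toℕ-replaceZero-0 : ∀ {x} b → toℕ x ≡ 0 → toℕ (replaceZero x b) ≡ withSign b (q + 1)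
  toℕ-replaceZero-0 b x≡0 = trans (cong toℕ (if-isZero-zero x≡0)) (toℕ-replacement b)

  -- Not definitional: zerosLabelled compares labels by a where-function closed over its arguments.
  zerosLabelled-∷ : ∀ b x c′ {k} (u : Vec (Fin Q) k) c →
                    zerosLabelled b (x ∷ u) (c′ ∷ c) ≡ zerosLabelled b (x ∷ []) (c′ ∷ []) + zerosLabelled b u c
  zerosLabelled-∷ true  x c′ u c =
    cong₂ _+_ (sym (+-identityʳ _)) (cong sum (zipWith-cong (λ { y true → refl ; y false → refl }) u c))
  zerosLabelled-∷ false x c′ u c =
    cong₂ _+_ (sym (+-identityʳ _)) (cong sum (zipWith-cong (λ { y true → refl ; y false → refl }) u c))

  toℕ-replaceZero : ∀ x b → toℕ (replaceZero x b) ≡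
    toℕ x + zerosLabelled true (x ∷ []) (b ∷ []) * withSign true (q + 1)
          + zerosLabelled false (x ∷ []) (b ∷ []) * withSign false (q + 1)
  toℕ-replaceZero x b with toℕ x in x≡
  toℕ-replaceZero x true  | zero  = trans (toℕ-replacement true)  (sym (trans (+-identityʳ _) (+-identityʳ _)))
  toℕ-replaceZero x false | zero  = trans (toℕ-replacement false) (sym (+-identityʳ _))
  toℕ-replaceZero x b     | suc y = trans x≡ (sym (trans (+-identityʳ _) (+-identityʳ _)))

  weight-replaceZeros : ∀ {k} (u : Vec (Fin Q) k) c →
    weight (replaceZeros q Q u c) ≡ weight u + zerosLabelled true u c * withSign true (q + 1)
                                             + zerosLabelled false u c * withSign false (q + 1)
  weight-replaceZeros [] [] = refl
  weight-replaceZeros (x ∷ u) (b ∷ c) = begin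
    toℕ (replaceZero x b) + weight (replaceZeros q Q u c)
      ≡⟨ cong₂ _+_ (toℕ-replaceZero x b) (weight-replaceZeros u c) ⟩
    toℕ x + t₁ * A + f₁ * B + (weight u + t * A + f * B)
      ≡⟨ rearrange (toℕ x) (weight u) t₁ t f₁ f A B ⟩
    toℕ x + weight u + (t₁ + t) * A + (f₁ + f) * B
      ≡⟨ cong₂ (λ t′ f′ → toℕ x + weight u + t′ * A + f′ * B)
               (zerosLabelled-∷ true x b u c) (zerosLabelled-∷ false x b u c) ⟨
    weight (x ∷ u) + zerosLabelled true (x ∷ u) (b ∷ c) * A + zerosLabelled false (x ∷ u) (b ∷ c) * B
      ∎
    where
    open ≡-Reasoning
    A = withSign true (q + 1)
    B = withSign false (q + 1)
    t₁ = zerosLabelled true (x ∷ []) (b ∷ [])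
    f₁ = zerosLabelled false (x ∷ []) (b ∷ [])
    t = zerosLabelled true u c
    f = zerosLabelled false u c
    rearrange : ∀ y w t₁ t f₁ f A B →
                y + t₁ * A + f₁ * B + (w + t * A + f * B) ≡ y + w + (t₁ + t) * A + (f₁ + f) * B
    rearrange = solve-∀

  ∣weight-replaceZeros : ∀ {k} (u : Vec (Fin Q) k) c → zerosLabelled true u c ≡ zerosLabelled false u c →
                         Q ∣ weight u → Q ∣ weight (replaceZeros q Q u c)
  ∣weight-replaceZeros u c balanced Q∣u = subst (Q ∣_) (sym weight≡) (∣m∣n⇒∣m+n Q∣u (n∣m*n z))
    where
    open ≡-Reasoning
    z = zerosLabelled true u c
    weight≡ : weight (replaceZeros q Q u c) ≡ weight u + z * Q
    weight≡ = begin
      weight (replaceZeros q Q u c)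
        ≡⟨ weight-replaceZeros u c ⟩
      weight u + z * (q + 1) + zerosLabelled false u c * (Q ∸ (q + 1))
        ≡⟨ cong (λ f → weight u + z * (q + 1) + f * (Q ∸ (q + 1))) balanced ⟨
      weight u + z * (q + 1) + z * (Q ∸ (q + 1))
        ≡⟨ +-assoc (weight u) _ _ ⟩
      weight u + (z * (q + 1) + z * (Q ∸ (q + 1)))
        ≡⟨ cong (weight u +_) (*-distribˡ-+ z (q + 1) (Q ∸ (q + 1))) ⟨
      weight u + z * (q + 1 + (Q ∸ (q + 1)))
        ≡⟨ cong (λ a → weight u + z * a) (m+[n∸m]≡n (<⇒≤ q+1<Q)) ⟩
      weight u + z * Q
        ∎

data Block : Set where
  s⁺ s⁻ t⁺ t⁻ : Block

next : Block → Block
next s⁺ = s⁻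
next s⁻ = t⁺
next t⁺ = t⁻
next t⁻ = s⁺

data Half : Set where
  first second : Half

half : Block → Half
half s⁺ = first
half s⁻ = first
half t⁺ = second
half t⁻ = second

sign : Block → Bool → Bool
sign s⁺ ε = true
sign s⁻ ε = false
sign t⁺ ε = ε
sign t⁻ ε = not ε

data Rotation : Block → Block → Set where
  same  : ∀ {b} → Rotation b b
  once  : ∀ {b} → Rotation b (next b)
  twice : ∀ {b} → Rotation b (next (next b))
  back  : ∀ {b} → Rotation (next b) b

rotation : ∀ b b′ → Rotation b b′
rotation s⁺ s⁺ = same
rotation s⁺ s⁻ = once
rotation s⁺ t⁺ = twice
rotation s⁺ t⁻ = back
rotation s⁻ s⁺ = back
rotation s⁻ s⁻ = same
rotation s⁻ t⁺ = once
rotation s⁻ t⁻ = twice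
rotation t⁺ s⁺ = twice
rotation t⁺ s⁻ = back
rotation t⁺ t⁺ = same
rotation t⁺ t⁻ = once
rotation t⁻ s⁺ = once
rotation t⁻ s⁻ = twice
rotation t⁻ t⁺ = back
rotation t⁻ t⁻ = same

data Agree (v : ℕ) (ε : Bool) (b b′ : Block) : Set where
  nonzero : v ≢ 0 → sign b ε ≡ sign b′ ε → Agree v ε b b′
  zeroₛ   : v ≡ 0 → half b ≡ first → half b′ ≡ first → Agree v ε b b′
  zeroₜ   : v ≡ 0 → half b ≡ second → half b′ ≡ second → sign b ε ≡ sign b′ ε → Agree v ε b b′

agree-once : ∀ {v ε} b → Agree v ε b (next b) → (b ≡ s⁺ × v ≡ 0) ⊎ (b ≢ s⁺ × v ≢ 0 × ε ≡ false)
agree-once s⁺ (nonzero _ ())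
agree-once s⁺ (zeroₛ v≡0 _ _)     = inj₁ (refl , v≡0)
agree-once s⁺ (zeroₜ _ () _ _)
agree-once s⁻ (nonzero v≢0 eq)     = inj₂ ((λ ()) , v≢0 , sym eq)
agree-once s⁻ (zeroₛ _ _ ())
agree-once s⁻ (zeroₜ _ () _ _)
agree-once t⁺ (nonzero _ eq)       = contradiction eq (not-¬ refl)
agree-once t⁺ (zeroₛ _ () _)
agree-once t⁺ (zeroₜ _ _ _ eq)     = contradiction eq (not-¬ refl)
agree-once t⁻ (nonzero v≢0 eq)     = inj₂ ((λ ()) , v≢0 , not-injective eq)
agree-once t⁻ (zeroₛ _ () _)
agree-once t⁻ (zeroₜ _ _ () _)

agree-twice : ∀ {v ε} b → Agree v ε b (next (next b)) → v ≢ 0 × ε ≡ true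
agree-twice {ε = true} b  (nonzero v≢0 _) = v≢0 , refl
agree-twice {ε = false} s⁺ (nonzero _ ())
agree-twice {ε = false} s⁻ (nonzero _ ())
agree-twice {ε = false} t⁺ (nonzero _ ())
agree-twice {ε = false} t⁻ (nonzero _ ())
agree-twice s⁺ (zeroₛ _ _ ())
agree-twice s⁻ (zeroₛ _ _ ())
agree-twice t⁺ (zeroₛ _ () _)
agree-twice t⁻ (zeroₛ _ () _)
agree-twice s⁺ (zeroₜ _ () _ _)
agree-twice s⁻ (zeroₜ _ () _ _)
agree-twice t⁺ (zeroₜ _ _ () _)
agree-twice t⁻ (zeroₜ _ _ () _)

module Construction (q Q m : ℕ) .{{_ : NonZero q}} .{{_ : NonZero Q}} .{{_ : NonZero m}}
                    (2q+2≤Q : 2 * q + 2 ≤ Q) (s : Vec (Fin q) m) (c : Vec Bool (m + m + (m + m))) where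

  open Signed Q

  q+1+q+1≤Q : q + 1 + (q + 1) ≤ Q
  q+1+q+1≤Q = subst (_≤ Q) (double q) 2q+2≤Q
    where
    double : ∀ q → 2 * q + 2 ≡ q + 1 + (q + 1)
    double = solve-∀

  q+q<Q : q + q < Q
  q+q<Q = <-≤-trans (+-mono-< (m<m+n q z<s) (m<m+n q z<s)) q+1+q+1≤Q

  q+1<Q : q + 1 < Q
  q+1<Q = <-≤-trans (m<m+n (q + 1) (m≤n+m 1 q)) q+1+q+1≤Q

  q<Q : q < Q
  q<Q = <-trans (m<m+n q z<s) q+1<Q

  open Replacement q Q q+1<Q

  M : ℕ
  M = m + m + (m + m)

  U U′ : Vec (Fin Q) M
  U  = USeq Q s
  U′ = replaceZeros q Q U c

  sℕ u′ℕ : ℕ → ℕ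
  sℕ j  = toℕ (term s j)
  u′ℕ x = toℕ (term U′ x)

  tSign : ℕ → Bool
  tSign j = even (j + m ∸ 1)

  tSign-suc : ∀ j → tSign (suc j) ≡ not (tSign j)
  tSign-suc j = begin
    even (suc j + m ∸ 1)   ≡⟨ cong even (+-∸-assoc (suc j) (>-nonZero⁻¹ m)) ⟩
    even (suc j + (m ∸ 1)) ≡⟨ even-suc (j + (m ∸ 1)) ⟩
    not (even (j + (m ∸ 1))) ≡⟨ cong (not ∘ even) (+-∸-assoc j (>-nonZero⁻¹ m)) ⟨
    not (tSign j)          ∎
    where open ≡-Reasoning

  tSign-last : ∀ {j} → suc j ≡ m → tSign j ≡ true
  tSign-last {j} refl = trans (cong (λ k → even (k ∸ 1)) (+-suc j j)) (even-+-self j)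

  offset : Block → ℕ
  offset s⁺ = 0
  offset s⁻ = m
  offset t⁺ = m + m
  offset t⁻ = m + m + m

  offset+m≤M : ∀ b → offset b + m ≤ M
  offset+m≤M s⁺ = ≤-trans (m≤m+n m m) (m≤m+n (m + m) (m + m))
  offset+m≤M s⁻ = m≤m+n (m + m) (m + m)
  offset+m≤M t⁺ = ≤-trans (m≤m+n (m + m + m) m) (≤-reflexive (+-assoc (m + m) m m))
  offset+m≤M t⁻ = ≤-reflexive (+-assoc (m + m) m m)

  offset+j<M : ∀ b {j} → j < m → offset b + j < M
  offset+j<M b j<m = <-≤-trans (+-monoʳ-< (offset b) j<m) (offset+m≤M b)

  m∣offset : ∀ b → m ∣ offset b
  m∣offset s⁺ = divides 0 refl
  m∣offset s⁻ = divides 1 (sym (+-identityʳ m))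
  m∣offset t⁺ = divides 2 (cong (m +_) (sym (+-identityʳ m)))
  m∣offset t⁻ = divides 3 (thrice m)
    where
    thrice : ∀ m → m + m + m ≡ 3 * m
    thrice = solve-∀

  %M-offset : ∀ {y} b {j} → y ≡ offset b + j → j < m → y % M ≡ offset b + j
  %M-offset b y≡ j<m = trans (cong (_% M) y≡) (m<n⇒m%n≡m (offset+j<M b j<m))

  offset-next : ∀ b {j} → j < m → (offset b + j + m) % M ≡ offset (next b) + j
  offset-next s⁺ {j} j<m = %M-offset s⁻ (+-comm j m) j<m
  offset-next s⁻ {j} j<m = %M-offset t⁺ (shuffle m j) j<m
    where
    shuffle : ∀ m j → m + j + m ≡ m + m + j
    shuffle = solve-∀
  offset-next t⁺ {j} j<m = %M-offset t⁻ (shuffle m j) j<m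
    where
    shuffle : ∀ m j → m + m + j + m ≡ m + m + m + j
    shuffle = solve-∀
  offset-next t⁻ {j} j<m = begin
    (m + m + m + j + m) % M ≡⟨ cong (_% M) (shuffle m j) ⟩
    (j + M) % M             ≡⟨ [m+n]%n≡m%n j M ⟩
    j % M                   ≡⟨ m<n⇒m%n≡m (offset+j<M s⁺ j<m) ⟩
    j                       ∎
    where
    open ≡-Reasoning
    shuffle : ∀ m j → m + m + m + j + m ≡ j + (m + m + (m + m))
    shuffle = solve-∀

  record At (x : ℕ) (b : Block) (j : ℕ) : Set where
    constructor at
    field
      j<m  : j < m
      x%M≡ : x % M ≡ offset b + j
  open At

  same-position : ∀ {x y b j} → At x b j → At y b j → x % M ≡ y % M
  same-position p p′ = trans (x%M≡ p) (sym (x%M≡ p′))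

  within : ∀ x b → offset b ≤ x % M → x % M < offset b + m → At x b (x % M ∸ offset b)
  within x b b≤x x<b+m = at (≤-trans (∸-monoˡ-< x<b+m b≤x) (≤-reflexive (m+n∸m≡n (offset b) m)))
                            (sym (m+[n∸m]≡n b≤x))

  position : ∀ x → Σ Block λ b → Σ ℕ (At x b)
  position x with x % M <? m | x % M <? m + m | x % M <? m + m + m
  ... | yes x<m | _         | _          = s⁺ , _ , within x s⁺ z≤n x<m
  ... | no x≮m  | yes x<2m  | _          = s⁻ , _ , within x s⁻ (≮⇒≥ x≮m) x<2m
  ... | no _    | no x≮2m   | yes x<3m   = t⁺ , _ , within x t⁺ (≮⇒≥ x≮2m) x<3m
  ... | no _    | no _      | no x≮3m    =
    t⁻ , _ , within x t⁻ (≮⇒≥ x≮3m) (<-≤-trans (m%n<n x M) (≤-reflexive (sym (+-assoc (m + m) m m))))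

  %M-+ : ∀ x a → (x + a) % M ≡ (x % M + a) % M
  %M-+ x a = %-cong-+ʳ a M (sym (m%n%n≡m%n x M))

  At-+m : ∀ {x b j} → At x b j → At (x + m) (next b) j
  At-+m {x} {b} {j} p = at (j<m p) (begin
    (x + m) % M            ≡⟨ %M-+ x m ⟩
    (x % M + m) % M        ≡⟨ cong (λ y → (y + m) % M) (x%M≡ p) ⟩
    (offset b + j + m) % M ≡⟨ offset-next b (j<m p) ⟩
    offset (next b) + j    ∎)
    where open ≡-Reasoning

  At-+2m : ∀ {x b j} → At x b j → At (x + (m + m)) (next (next b)) j
  At-+2m {x} {b} {j} p = subst (λ y → At y (next (next b)) j) (+-assoc x m m) (At-+m (At-+m p))

  suc-%M : ∀ {x b j} → At x b j → suc x % M ≡ (offset b + suc j) % M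
  suc-%M {x} {b} {j} p = begin
    suc x % M              ≡⟨ cong (_% M) (+-comm 1 x) ⟩
    (x + 1) % M            ≡⟨ %M-+ x 1 ⟩
    (x % M + 1) % M        ≡⟨ cong (λ y → (y + 1) % M) (x%M≡ p) ⟩
    (offset b + j + 1) % M ≡⟨ cong (_% M) (trans (+-assoc (offset b) j 1) (cong (offset b +_) (+-comm j 1))) ⟩
    (offset b + suc j) % M ∎
    where open ≡-Reasoning

  At-suc : ∀ {x b j} → At x b j → At (suc x) b (suc j) ⊎ (suc j ≡ m × At (suc x) (next b) 0)
  At-suc {x} {b} {j} p with suc j <? m
  ... | yes 1+j<m = inj₁ (at 1+j<m (trans (suc-%M p) (m<n⇒m%n≡m (offset+j<M b 1+j<m))))
  ... | no 1+j≮m  = inj₂ (1+j≡m , at (>-nonZero⁻¹ m) (begin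
    suc x % M              ≡⟨ suc-%M p ⟩
    (offset b + suc j) % M ≡⟨ cong (λ k → (offset b + k) % M) 1+j≡m ⟩
    (offset b + m) % M     ≡⟨ cong (λ k → (k + m) % M) (+-identityʳ (offset b)) ⟨
    (offset b + 0 + m) % M ≡⟨ offset-next b (>-nonZero⁻¹ m) ⟩
    offset (next b) + 0    ∎))
    where
    open ≡-Reasoning
    1+j≡m : suc j ≡ m
    1+j≡m = ≤-antisym (j<m p) (≮⇒≥ 1+j≮m)

  At-%m : ∀ {x b j} → At x b j → x % m ≡ j
  At-%m {x} {b} {j} p = begin
    x % m             ≡⟨ m∣n⇒o%n%m≡o%m m M x (divides 4 (four m)) ⟨
    x % M % m         ≡⟨ cong (_% m) (x%M≡ p) ⟩
    (offset b + j) % m ≡⟨ %-remove-+ˡ j (m∣offset b) ⟩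
    j % m             ≡⟨ m<n⇒m%n≡m (j<m p) ⟩
    j                 ∎
    where
    open ≡-Reasoning
    four : ∀ m → m + m + (m + m) ≡ 4 * m
    four = solve-∀

  magnitude : Half → Fin q → Fin Q
  magnitude first  a = lift Q a
  magnitude second a = if isZero (lift Q a) then q mod Q else lift Q a

  blockIndex : Block → Fin m → Fin M
  blockIndex s⁺ i = (i ↑ˡ m) ↑ˡ (m + m)
  blockIndex s⁻ i = (m ↑ʳ i) ↑ˡ (m + m)
  blockIndex t⁺ i = (m + m) ↑ʳ (i ↑ˡ m)
  blockIndex t⁻ i = (m + m) ↑ʳ (m ↑ʳ i)

  toℕ-blockIndex : ∀ b i → toℕ (blockIndex b i) ≡ offset b + toℕ i
  toℕ-blockIndex s⁺ i = trans (toℕ-↑ˡ (i ↑ˡ m) (m + m)) (toℕ-↑ˡ i m)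
  toℕ-blockIndex s⁻ i = trans (toℕ-↑ˡ (m ↑ʳ i) (m + m)) (toℕ-↑ʳ m i)
  toℕ-blockIndex t⁺ i = trans (toℕ-↑ʳ (m + m) (i ↑ˡ m)) (cong (m + m +_) (toℕ-↑ˡ i m))
  toℕ-blockIndex t⁻ i =
    trans (toℕ-↑ʳ (m + m) (m ↑ʳ i)) (trans (cong (m + m +_) (toℕ-↑ʳ m i)) (sym (+-assoc (m + m) m (toℕ i))))

  s′ t : Vec (Fin Q) m
  s′ = map (lift Q) s
  t  = tSeq Q s

  lookup-U : ∀ b i → lookup U (blockIndex b i) ≡ sgn (sign b (tSign (toℕ i))) (magnitude (half b) (lookup s i))
  lookup-U s⁺ i = begin
    lookup U ((i ↑ˡ m) ↑ˡ (m + m)) ≡⟨ lookup-++ˡ (s′ ++ map neg s′) (t ++ map neg t) (i ↑ˡ m) ⟩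
    lookup (s′ ++ map neg s′) (i ↑ˡ m) ≡⟨ lookup-++ˡ s′ (map neg s′) i ⟩
    lookup s′ i                        ≡⟨ lookup-map i (lift Q) s ⟩
    lift Q (lookup s i)                ∎
    where open ≡-Reasoning
  lookup-U s⁻ i = begin
    lookup U ((m ↑ʳ i) ↑ˡ (m + m))     ≡⟨ lookup-++ˡ (s′ ++ map neg s′) (t ++ map neg t) (m ↑ʳ i) ⟩
    lookup (s′ ++ map neg s′) (m ↑ʳ i) ≡⟨ lookup-++ʳ s′ (map neg s′) i ⟩
    lookup (map neg s′) i              ≡⟨ lookup-map i neg s′ ⟩
    neg (lookup s′ i)                  ≡⟨ cong neg (lookup-map i (lift Q) s) ⟩
    neg (lift Q (lookup s i))          ∎
    where open ≡-Reasoning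
  lookup-U t⁺ i = begin
    lookup U ((m + m) ↑ʳ (i ↑ˡ m))     ≡⟨ lookup-++ʳ (s′ ++ map neg s′) (t ++ map neg t) (i ↑ˡ m) ⟩
    lookup (t ++ map neg t) (i ↑ˡ m)   ≡⟨ lookup-++ˡ t (map neg t) i ⟩
    lookup t i                         ≡⟨ lookup∘tabulate _ i ⟩
    sgn (tSign (toℕ i)) (magnitude second (lookup s i)) ∎
    where open ≡-Reasoning
  lookup-U t⁻ i = begin
    lookup U ((m + m) ↑ʳ (m ↑ʳ i))     ≡⟨ lookup-++ʳ (s′ ++ map neg s′) (t ++ map neg t) (m ↑ʳ i) ⟩
    lookup (t ++ map neg t) (m ↑ʳ i)   ≡⟨ lookup-++ʳ t (map neg t) i ⟩
    lookup (map neg t) i               ≡⟨ lookup-map i neg t ⟩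
    neg (lookup t i)                   ≡⟨ cong neg (lookup∘tabulate _ i) ⟩
    neg (sgn (tSign (toℕ i)) (magnitude second (lookup s i))) ≡⟨ neg-sgn (tSign (toℕ i)) _ ⟩
    sgn (not (tSign (toℕ i))) (magnitude second (lookup s i)) ∎
    where open ≡-Reasoning

  term-U′ : ∀ {x b j} → At x b j →
            term U′ x ≡ replaceZero (sgn (sign b (tSign j)) (magnitude (half b) (term s j))) (lookup c (x mod M))
  term-U′ {x} {b} {j} p = begin
    term U′ x                                                   ≡⟨ lookup-zipWith _ (x mod M) U c ⟩
    replace (lookup U (x mod M))                                ≡⟨ cong (replace ∘ lookup U) x-index ⟩
    replace (lookup U (blockIndex b (j mod m)))                 ≡⟨ cong replace (lookup-U b (j mod m)) ⟩
    replace (entryAt (toℕ (j mod m)))                           ≡⟨ cong (replace ∘ entryAt) toℕ-j ⟩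
    replace (entryAt j)                                         ∎
    where
    open ≡-Reasoning
    replace : Fin Q → Fin Q
    replace y = replaceZero y (lookup c (x mod M))
    entryAt : ℕ → Fin Q
    entryAt k = sgn (sign b (tSign k)) (magnitude (half b) (term s j))
    toℕ-j : toℕ (j mod m) ≡ j
    toℕ-j = trans (toℕ-mod j m) (m<n⇒m%n≡m (j<m p))
    x-index : x mod M ≡ blockIndex b (j mod m)
    x-index = toℕ-injective (trans (toℕ-mod x M) (trans (x%M≡ p)
                (sym (trans (toℕ-blockIndex b (j mod m)) (cong (offset b +_) toℕ-j)))))

  -- The possible values y of U′ at offset j of block b, for v = s_j and ε = tSign j:
  -- the zeros of the s-blocks have been replaced by ±(q + 1), those of t are ±q.
  data Entry (v : ℕ) (ε : Bool) (b : Block) (y : ℕ) : Set where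
    nonzero : v ≢ 0 → y ≡ withSign (sign b ε) v → Entry v ε b y
    zeroₛ   : v ≡ 0 → half b ≡ first → ∀ σ → y ≡ withSign σ (q + 1) → Entry v ε b y
    zeroₜ   : v ≡ 0 → half b ≡ second → y ≡ withSign (sign b ε) q → Entry v ε b y

  toℕ-lift : (a : Fin q) → toℕ (lift Q a) ≡ toℕ a
  toℕ-lift a = trans (toℕ-mod (toℕ a) Q) (m<n⇒m%n≡m (<-trans (toℕ<n a) q<Q))

  toℕ-magnitude : ∀ h {a} → toℕ a ≢ 0 → toℕ (magnitude h a) ≡ toℕ a
  toℕ-magnitude first  {a} a≢0 = toℕ-lift a
  toℕ-magnitude second {a} a≢0 =
    trans (cong toℕ (if-isZero-nonzero (a≢0 ∘ trans (sym (toℕ-lift a))))) (toℕ-lift a)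

  toℕ-magnitude-0 : ∀ {a} → toℕ a ≡ 0 → toℕ (magnitude second a) ≡ q
  toℕ-magnitude-0 {a} a≡0 =
    trans (cong toℕ (if-isZero-zero (trans (toℕ-lift a) a≡0))) (trans (toℕ-mod q Q) (m<n⇒m%n≡m q<Q))

  toℕ-replaceZero-sgn : ∀ σ {y} c′ → toℕ y ≢ 0 → toℕ (replaceZero (sgn σ y) c′) ≡ withSign σ (toℕ y)
  toℕ-replaceZero-sgn σ {y} c′ y≢0 = trans (cong toℕ (if-isZero-nonzero sgn≢0)) (toℕ-sgn σ y y≢0)
    where
    sgn≢0 : toℕ (sgn σ y) ≢ 0
    sgn≢0 = subst (_≢ 0) (sym (toℕ-sgn σ y y≢0)) (withSign-nonzero σ y≢0 (toℕ<n y))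

  entry-of : ∀ b ε (a : Fin q) c′ →
             Entry (toℕ a) ε b (toℕ (replaceZero (sgn (sign b ε) (magnitude (half b) a)) c′))
  entry-of b ε a c′ with toℕ a ≟ 0
  ... | no a≢0 = nonzero a≢0 (trans (toℕ-replaceZero-sgn (sign b ε) c′ mag≢0) (cong (withSign (sign b ε)) mag≡))
    where
    mag≡ = toℕ-magnitude (half b) a≢0
    mag≢0 = subst (_≢ 0) (sym mag≡) a≢0
  ... | yes a≡0 with half b in h
  ...   | first  =
    zeroₛ a≡0 h c′ (toℕ-replaceZero-0 c′ (toℕ-sgn-0 (sign b ε) (lift Q a) (trans (toℕ-lift a) a≡0)))
  ...   | second =
    zeroₜ a≡0 h (trans (toℕ-replaceZero-sgn (sign b ε) c′ mag≢0) (cong (withSign (sign b ε)) mag≡))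
    where
    mag≡ = toℕ-magnitude-0 a≡0
    mag≢0 = subst (_≢ 0) (sym mag≡) (≢-nonZero⁻¹ q)

  entry : ∀ {x b j} → At x b j → Entry (sℕ j) (tSign j) b (u′ℕ x)
  entry {x} {b} {j} p =
    subst (Entry (sℕ j) (tSign j) b) (sym (cong toℕ (term-U′ p))) (entry-of b (tSign j) (term s j) (lookup c (x mod M)))

  v+v<Q : ∀ {v} → v < q → v + v < Q
  v+v<Q v<q = ≤-<-trans (+-mono-≤ (<⇒≤ v<q) (<⇒≤ v<q)) q+q<Q

  q+1≢q : q + 1 ≢ q
  q+1≢q eq = <-irrefl (sym eq) (m<m+n q z<s)

  entry-agree : ∀ {v ε b b′ y y′} → v < q →
                Entry v ε b y → Entry v ε b′ y′ → y ≡ y′ → Agree v ε b b′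
  entry-agree v<q (nonzero v≢0 e) (nonzero _ e′) eq =
    nonzero v≢0 (withSign-injectiveˡ _ _ (v+v<Q v<q) (trans (sym e) (trans eq e′)))
  entry-agree _ (nonzero v≢0 _) (zeroₛ v≡0 _ _ _) _ = contradiction v≡0 v≢0
  entry-agree _ (nonzero v≢0 _) (zeroₜ v≡0 _ _)   _ = contradiction v≡0 v≢0
  entry-agree _ (zeroₛ v≡0 _ _ _) (nonzero v≢0 _) _ = contradiction v≡0 v≢0
  entry-agree _ (zeroₜ v≡0 _ _)   (nonzero v≢0 _) _ = contradiction v≡0 v≢0
  entry-agree _ (zeroₛ v≡0 h _ _) (zeroₛ _ h′ _ _) _ = zeroₛ v≡0 h h′
  entry-agree _ (zeroₜ v≡0 h e) (zeroₜ _ h′ e′) eq =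
    zeroₜ v≡0 h h′ (withSign-injectiveˡ _ _ q+q<Q (trans (sym e) (trans eq e′)))
  entry-agree _ (zeroₛ _ _ σ e) (zeroₜ _ _ e′) eq =
    contradiction (withSign-injectiveʳ σ _ q+1+q+1≤Q (<⇒≤ q+q<Q) (trans (sym e) (trans eq e′))) q+1≢q
  entry-agree _ (zeroₜ _ _ e) (zeroₛ _ _ σ e′) eq =
    contradiction (withSign-injectiveʳ σ _ q+1+q+1≤Q (<⇒≤ q+q<Q) (trans (sym e′) (trans (sym eq) e))) q+1≢q

  project-entry : ∀ {v ε b y} → v < q → Entry v ε b y → project q y ≡ v
  project-entry v<q (nonzero _ e) =
    trans (cong (project q) e) (trans (project-withSign q _ (<⇒≤ (v+v<Q v<q))) (clip-< v<q))
  project-entry _ (zeroₛ v≡0 _ σ e) =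
    trans (cong (project q) e) (trans (project-withSign q σ q+1+q+1≤Q) (trans (clip-≥ (m≤m+n q 1)) (sym v≡0)))
  project-entry {ε = ε} {b} _ (zeroₜ v≡0 _ e) =
    trans (cong (project q) e)
          (trans (project-withSign q (sign b ε) (<⇒≤ q+q<Q)) (trans (clip-≥ {q} ≤-refl) (sym v≡0)))

  entry-nonzero : ∀ {v ε b y} → v < q → Entry v ε b y → y ≢ 0
  entry-nonzero v<q (nonzero v≢0 e) y≡0 = withSign-nonzero _ v≢0 (<-trans v<q q<Q) (trans (sym e) y≡0)
  entry-nonzero _ (zeroₛ _ _ σ e)     y≡0 = withSign-nonzero σ (m+1+n≢0 q) q+1<Q (trans (sym e) y≡0)
  entry-nonzero _ (zeroₜ _ _ e)       y≡0 = withSign-nonzero _ (≢-nonZero⁻¹ q) q<Q (trans (sym e) y≡0)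

  sℕ<q : ∀ j → sℕ j < q
  sℕ<q j = toℕ<n (term s j)

  sℕ-At : ∀ {x b j} → At x b j → sℕ x ≡ sℕ j
  sℕ-At p = cong toℕ (term-cong s (trans (At-%m p) (sym (m<n⇒m%n≡m (j<m p)))))

  project-u′ : ∀ x → project q (u′ℕ x) ≡ sℕ x
  project-u′ x with position x
  ... | _ , _ , p = trans (project-entry (sℕ<q _) (entry p)) (sym (sℕ-At p))

  u′-nonzero : ∀ x → u′ℕ x ≢ 0
  u′-nonzero x with position x
  ... | _ , _ , p = entry-nonzero (sℕ<q _) (entry p)

  agree-at : ∀ {x x′ b b′ j} → At x b j → At x′ b′ j → u′ℕ x ≡ u′ℕ x′ → Agree (sℕ j) (tSign j) b b′
  agree-at p p′ = entry-agree (sℕ<q _) (entry p) (entry p′)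

  module _ (s₀≡0 : sℕ 0 ≡ 0) where

    repeat-m⇒zeros : ∀ y → u′ℕ y ≡ u′ℕ (y + m) → u′ℕ (suc y) ≡ u′ℕ (suc y + m) →
                     sℕ y ≡ 0 × sℕ (suc y) ≡ 0
    repeat-m⇒zeros y eq₀ eq₁ with position y
    ... | b , j , p with agree-once b (agree-at p (At-+m p) eq₀) | At-suc p
    ... | inj₁ (refl , z) | inj₁ p₁ with agree-once s⁺ (agree-at p₁ (At-+m p₁) eq₁)
    ...   | inj₁ (_ , z₁)    = trans (sℕ-At p) z , trans (sℕ-At p₁) z₁
    ...   | inj₂ (s⁺≢s⁺ , _) = contradiction refl s⁺≢s⁺
    repeat-m⇒zeros y eq₀ eq₁ | b , j , p | inj₂ (b≢s⁺ , _ , ε≡false) | inj₁ p₁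
      with agree-once b (agree-at p₁ (At-+m p₁) eq₁)
    ...   | inj₁ (b≡s⁺ , _)         = contradiction b≡s⁺ b≢s⁺
    ...   | inj₂ (_ , _ , ε₁≡false) =
      contradiction (trans (sym ε₁≡false) (trans (tSign-suc j) (cong not ε≡false))) λ ()
    repeat-m⇒zeros y eq₀ eq₁ | b , j , p | inj₁ (refl , _) | inj₂ (_ , p₁)
      with agree-once s⁻ (agree-at p₁ (At-+m p₁) eq₁)
    ...   | inj₂ (_ , s₀≢0 , _) = contradiction s₀≡0 s₀≢0
    repeat-m⇒zeros y eq₀ eq₁ | b , j , p | inj₂ (_ , _ , ε≡false) | inj₂ (1+j≡m , _) =
      contradiction (trans (sym ε≡false) (tSign-last 1+j≡m)) λ ()

    no-repeat-2m : ∀ y → u′ℕ y ≡ u′ℕ (y + (m + m)) → u′ℕ (suc y) ≢ u′ℕ (suc y + (m + m))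
    no-repeat-2m y eq₀ eq₁ with position y
    ... | b , j , p with agree-twice b (agree-at p (At-+2m p) eq₀) | At-suc p
    ... | _ , ε≡true | inj₁ p₁ =
      contradiction (trans (sym ε₁≡true) (trans (tSign-suc j) (cong not ε≡true))) λ ()
      where ε₁≡true = proj₂ (agree-twice b (agree-at p₁ (At-+2m p₁) eq₁))
    ... | _ | inj₂ (_ , p₁) = proj₁ (agree-twice (next b) (agree-at p₁ (At-+2m p₁) eq₁)) s₀≡0

    module _ {n} (1<n : 1 < n) (os : IsOS n s) where

      open Projection U′ s (project q ∘ toℕ) project-u′ n

      repeat-shift : ∀ {x d} → window n U′ x ≡ window n U′ (x + d) →
                     ∀ {i} → i < n → u′ℕ (x + i) ≡ u′ℕ (x + i + d)
      repeat-shift {x} {d} eq {i} i<n = cong toℕ (trans (window-≡⇒term-≡ U′ eq i<n) (cong (term U′) (swap x d i)))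
        where
        swap : ∀ x d i → x + d + i ≡ x + i + d
        swap = solve-∀

      no-period-m : ∀ x → window n U′ x ≢ window n U′ (x + m)
      no-period-m x eq = proj₂ os x x (trans constant (sym (trans (cong reverse constant) (reverse-replicate n _))))
        where
        zeros : ∀ {i} → suc i < n → sℕ (x + i) ≡ 0 × sℕ (suc (x + i)) ≡ 0
        zeros {i} 1+i<n = repeat-m⇒zeros (x + i) (repeat-shift eq (<-trans (n<1+n i) 1+i<n))
                            (subst (λ z → u′ℕ z ≡ u′ℕ (z + m)) (+-suc x i) (repeat-shift eq 1+i<n))
        zero-at : ∀ {i} → i < n → sℕ (x + i) ≡ 0
        zero-at {zero}  _     = proj₁ (zeros 1<n)
        zero-at {suc i} 1+i<n = trans (cong sℕ (+-suc x i)) (proj₂ (zeros 1+i<n))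
        constant : window n s x ≡ replicate n (term s (x + 0))
        constant = window-const s (λ i<n → toℕ-injective (trans (zero-at i<n) (sym (zero-at (<-trans z<s 1<n)))))

      no-period-2m : ∀ x → window n U′ x ≢ window n U′ (x + (m + m))
      no-period-2m x eq = no-repeat-2m (x + 0) (repeat-shift eq (<-trans z<s 1<n))
                            (subst (λ z → u′ℕ z ≡ u′ℕ (z + (m + m))) (+-suc x 0) (repeat-shift eq 1<n))

      window-injective : IsWindowSeq n U′
      window-injective x y eq with position x | position y
      ... | b , j , p | b′ , j′ , p′
        with trans (sym (At-%m p)) (trans (proj₁ os x y (window-≡-reflect eq)) (At-%m p′))
      ... | refl with rotation b b′
      ... | same  = same-position p p′
      ... | once  = ⊥-elim (no-period-m x (trans eq (window-cong U′ n (same-position p′ (At-+m p)))))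
      ... | twice = ⊥-elim (no-period-2m x (trans eq (window-cong U′ n (same-position p′ (At-+2m p)))))
      ... | back  = ⊥-elim (no-period-m y (trans (sym eq) (window-cong U′ n (same-position p (At-+m p′)))))

      isSOS : IsSOS n U′
      isSOS = (window-injective , λ x y eq → proj₂ os x y (reverse-reflect eq))
            , λ x y eq → proj₂ os x y (neg-reverse-reflect (project-neg q) eq)

  ∣weight-U′ : zerosLabelled true U c ≡ zerosLabelled false U c → Q ∣ weight U′
  ∣weight-U′ balanced = ∣weight-replaceZeros U c balanced
    (subst (Q ∣_) (sym (weight-++ (s′ ++ map neg s′) (t ++ map neg t)))
                  (∣m∣n⇒∣m+n (∣weight-++-neg s′) (∣weight-++-neg t)))

theorem4p4 : (q q' n m : ℕ) .{{_ : NonZero q}} .{{_ : NonZero q'}} .{{_ : NonZero m}}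
    → 2 * q + 2 ≤ q' → 1 < q → 1 < n
    → (s : Vec (Fin q) m) → IsOS n s
    → (s0 : ∀ (i : Fin m) → toℕ i ≡ 0 → toℕ (lookup s i) ≡ 0)
    → (c : Vec Bool (m + m + (m + m)))
    → zerosLabelled true (USeq q' s) c ≡ zerosLabelled false (USeq q' s) c
    → IsGood n (replaceZeros q q' (USeq q' s) c)
      × IsSOS n (replaceZeros q q' (USeq q' s) c)
      × weight (replaceZeros q q' (USeq q' s) c) % q' ≡ 0
theorem4p4 q q′ n m 2q+2≤q′ _ 1<n s os s₀ c balanced =
  no-zeros⇒good U′ u′-nonzero 1<n , isSOS s₀≡0 1<n os , n∣m⇒m%n≡0 _ q′ (∣weight-U′ balanced)
  where
  open Construction q q′ m 2q+2≤q′ s c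
  s₀≡0 : sℕ 0 ≡ 0
  s₀≡0 = s₀ (0 mod m) (trans (toℕ-mod 0 m) (m<n⇒m%n≡m (>-nonZero⁻¹ m)))
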